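{- Let $R$ be a word rewriting system over $\Sigma$ and $L_R$ its associated strictly positive logic. For all words $A,B\in\Sigma^*$ and any propositional variable $p$: $A\twoheadrightarrow_R B$ if and only if $Ap\vdash_{L_R} Bp$.
   Context: A word rewriting (semi-Thue) system $R$ over an alphabet $\Sigma$ is a set of rules $U\mapsto V$ with $U,V\in\Sigma^*$. A rule application transforms $XUY$ into $XVY$ for words $X,Y$. $A\twoheadrightarrow_R B$ means there is a finite sequence of words starting with $A$ and ending with $B$, each obtained from the previous one by applying a rule of $R$. Strictly positive formulas over $\Sigma$ (each letter of $\Sigma$ read as a diamond modality): $A::= p \mid \top \mid (A\land B)\mid aA$, $p$ a propositional variable, $a\in\Sigma$. For a word $A=a_1\cdots a_n$ and a formula $C$, $AC$ denotes the formula $a_1a_2\cdots a_nC$ (just $C$ if $A$ is empty). The system $\mathbf{K}^+$ consists of: $A\vdash A$; $A\vdash\top$; from $A\vdash B$, $B\vdash C$ infer $A\vdash C$; $A\land B\vdash A$; $A\land B\vdash B$; from $A\vdash B$, $A\vdash C$ infer $A\vdash B\land C$; from $A\vdash B$ infer $aA\vdash aB$. The logic $L_R$ is the normal strictly positive logic obtained from $\mathbf{K}^+$ by adding the axioms $Up\vdash Vp$ for each rule $U\mapsto V$ of $R$; i.e. the smallest set of sequents containing the axioms of $\mathbf{K}^+$ and all sequents $UC\vdash VC$ ($U\mapsto V$ in $R$, $C$ any strictly positive formula), closed under the rules of $\mathbf{K}^+$. $A\vdash_{L_R}B$ means $A\vdash B\in L_R$. -}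

module Defs where

open import Level using (Level; _⊔_; suc)
open import Data.List using (List; []; _∷_; _++_)

Word : ∀ {s} → Set s → Set s
Word Σ = List Σ

RewritingSystem : ∀ {s} (r : Level) → Set s → Set (s ⊔ suc r)
RewritingSystem r Σ = Word Σ → Word Σ → Set r

data Step {s r} {Σ : Set s} (R : RewritingSystem r Σ) : Word Σ → Word Σ → Set (s ⊔ r) where
  step : ∀ X U V Y → R U V → Step R (X ++ U ++ Y) (X ++ V ++ Y)

data _⊢_↠_ {s r} {Σ : Set s} (R : RewritingSystem r Σ) : Word Σ → Word Σ → Set (s ⊔ r) where
  done : ∀ {A} → R ⊢ A ↠ A
  _then_ : ∀ {A B C} → Step R A B → R ⊢ B ↠ C → R ⊢ A ↠ C

data Fm {s v} (Σ : Set s) (Var : Set v) : Set (s ⊔ v) where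
  var : Var → Fm Σ Var
  ⊤ : Fm Σ Var
  _∧_ : Fm Σ Var → Fm Σ Var → Fm Σ Var
  ◇ : Σ → Fm Σ Var → Fm Σ Var

_·_ : ∀ {s v} {Σ : Set s} {Var : Set v} → Word Σ → Fm Σ Var → Fm Σ Var
[] · C = C
(a ∷ A) · C = ◇ a (A · C)

-- Derivability in L_R: K⁺ plus the axioms U C ⊢ V C for each rule U ↦ V and every formula C.
data L {s r v} {Σ : Set s} (R : RewritingSystem r Σ) (Var : Set v)
     : Fm Σ Var → Fm Σ Var → Set (s ⊔ r ⊔ v) where
  refl′ : ∀ {A} → L R Var A A
  top : ∀ {A} → L R Var A ⊤
  trans′ : ∀ {A B C} → L R Var A B → L R Var B C → L R Var A C
  ∧-el : ∀ {A B} → L R Var (A ∧ B) A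
  ∧-er : ∀ {A B} → L R Var (A ∧ B) B
  ∧-intro : ∀ {A B C} → L R Var A B → L R Var A C → L R Var A (B ∧ C)
  mono : ∀ {a A B} → L R Var A B → L R Var (◇ a A) (◇ a B)
  axiom : ∀ {U V} → R U V → (C : Fm Σ Var) → L R Var (U · C) (V · C)

module Submission where

-- (⇒) Each rewriting step X U Y → X V Y is an instance of the axiom
--     U C ⊢ V C with C := Y p, transported under the diamonds X by
--     monotonicity; steps are then chained by transitivity.
-- (⇐) We build the canonical model on words: a formula φ holds at a word X
--     when X can be rewritten to "witness" φ, with  p  true at X iff X ↠ [],
--     and  a φ  true at X iff X ↠ a Y for some Y satisfying φ.  Truth is
--     closed under backward rewriting, so every L_R-derivable sequent is
--     valid in this model (soundness).  By the truth lemma,  B p  holds at X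
--     exactly when X ↠ B.  Since  A p  holds at A, soundness of  A p ⊢ B p
--     gives that  B p  holds at A, i.e. A ↠ B.

open import Defs
open import Level using (_⊔_)
open import Function.Bundles using (_⇔_; mk⇔)
open import Data.List using ([]; _∷_; _++_)
open import Data.List.Properties using (++-assoc; ++-identityʳ)
open import Data.Product using (Σ-syntax; _×_; _,_)
open import Data.Unit.Polymorphic using () renaming (⊤ to Unit)
open import Relation.Binary.PropositionalEquality using (_≡_; refl; sym; cong; subst; subst₂)

module Rewriting {s r} {Σ : Set s} (R : RewritingSystem r Σ) where

  ↠-trans : ∀ {A B C} → R ⊢ A ↠ B → R ⊢ B ↠ C → R ⊢ A ↠ C
  ↠-trans done q = q
  ↠-trans (x then p) q = x then ↠-trans p q

  ↠-step : ∀ {A B} → Step R A B → R ⊢ A ↠ B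
  ↠-step x = x then done

  step-prefix : ∀ W {A B} → Step R A B → Step R (W ++ A) (W ++ B)
  step-prefix W (step X U V Y u) =
    subst₂ (Step R) (++-assoc W X (U ++ Y)) (++-assoc W X (V ++ Y))
      (step (W ++ X) U V Y u)

  ↠-prefix : ∀ W {A B} → R ⊢ A ↠ B → R ⊢ (W ++ A) ↠ (W ++ B)
  ↠-prefix W done = done
  ↠-prefix W (x then p) = step-prefix W x then ↠-prefix W p

module Prefixes {s r v} {Σ : Set s} (R : RewritingSystem r Σ) (Var : Set v) where

  ·-++ : ∀ (X Y : Word Σ) (C : Fm Σ Var) → (X ++ Y) · C ≡ X · (Y · C)
  ·-++ [] Y C = refl
  ·-++ (a ∷ X) Y C = cong (◇ a) (·-++ X Y C)

  mono* : ∀ X {A B} → L R Var A B → L R Var (X · A) (X · B)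
  mono* [] d = d
  mono* (a ∷ X) d = mono (mono* X d)

  step-derivable : ∀ {A B} → Step R A B → (C : Fm Σ Var) → L R Var (A · C) (B · C)
  step-derivable (step X U V Y u) C
    rewrite ·-++ X (U ++ Y) C | ·-++ X (V ++ Y) C | ·-++ U Y C | ·-++ V Y C
    = mono* X (axiom u (Y · C))

  ↠-derivable : ∀ {A B} → R ⊢ A ↠ B → (C : Fm Σ Var) → L R Var (A · C) (B · C)
  ↠-derivable done C = refl′
  ↠-derivable (x then p) C = trans′ (step-derivable x C) (↠-derivable p C)

module CanonicalModel {s r v} {Σ : Set s} (R : RewritingSystem r Σ) (Var : Set v) where
  open Rewriting R

  ⟦_⟧ : Fm Σ Var → Word Σ → Set (s ⊔ r)
  ⟦ var q ⟧ X = R ⊢ X ↠ []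
  ⟦ ⊤ ⟧ X = Unit
  ⟦ φ ∧ ψ ⟧ X = ⟦ φ ⟧ X × ⟦ ψ ⟧ X
  ⟦ ◇ a φ ⟧ X = Σ[ Y ∈ Word Σ ] ⟦ φ ⟧ Y × R ⊢ X ↠ (a ∷ Y)

  ⟦⟧-backward : ∀ φ {X Y} → R ⊢ X ↠ Y → ⟦ φ ⟧ Y → ⟦ φ ⟧ X
  ⟦⟧-backward (var q) p h = ↠-trans p h
  ⟦⟧-backward ⊤ p h = h
  ⟦⟧-backward (φ ∧ ψ) p (h , k) = ⟦⟧-backward φ p h , ⟦⟧-backward ψ p k
  ⟦⟧-backward (◇ a φ) p (Z , h , q) = Z , h , ↠-trans p q

  prefix-elim : ∀ U C {X} → ⟦ U · C ⟧ X → Σ[ Y ∈ Word Σ ] ⟦ C ⟧ Y × R ⊢ X ↠ (U ++ Y)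
  prefix-elim [] C h = _ , h , done
  prefix-elim (a ∷ U) C (Z , h , q) with prefix-elim U C h
  ... | Y , c , q′ = Y , c , ↠-trans q (↠-prefix (a ∷ []) q′)

  prefix-intro : ∀ U C {X Y} → ⟦ C ⟧ Y → R ⊢ X ↠ (U ++ Y) → ⟦ U · C ⟧ X
  prefix-intro [] C c q = ⟦⟧-backward C q c
  prefix-intro (a ∷ U) C {Y = Y} c q = U ++ Y , prefix-intro U C c done , q

  -- Soundness: every L_R-derivable sequent holds at every word.  The only
  -- non-routine case is the rule axiom, which is one more rewriting step.
  sound : ∀ {φ ψ} → L R Var φ ψ → ∀ {X} → ⟦ φ ⟧ X → ⟦ ψ ⟧ X
  sound refl′ h = h
  sound top h = _
  sound (trans′ d e) h = sound e (sound d h)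
  sound ∧-el (h , _) = h
  sound ∧-er (_ , h) = h
  sound (∧-intro d e) h = sound d h , sound e h
  sound (mono d) (Z , h , q) = Z , sound d h , q
  sound (axiom {U} {V} u C) h with prefix-elim U C h
  ... | Y , c , q = prefix-intro V C c (↠-trans q (↠-step (step [] U V Y u)))

  truth : ∀ B (p : Var) {X} → R ⊢ X ↠ B → ⟦ B · var p ⟧ X
  truth B p {X} q = prefix-intro B (var p) done (subst (R ⊢ X ↠_) (sym (++-identityʳ B)) q)

  truth⁻¹ : ∀ B (p : Var) {X} → ⟦ B · var p ⟧ X → R ⊢ X ↠ B
  truth⁻¹ B p h with prefix-elim B (var p) h
  ... | Y , Y↠[] , q = ↠-trans q (subst (R ⊢ B ++ Y ↠_) (++-identityʳ B) (↠-prefix B Y↠[]))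

mainTheorem5 : ∀ {s r v} {Σ : Set s} (R : RewritingSystem r Σ) (Var : Set v)
    (A B : Word Σ) (p : Var) →
    (R ⊢ A ↠ B) ⇔ L R Var (A · var p) (B · var p)
mainTheorem5 R Var A B p = mk⇔ to from
  where
  open Prefixes R Var using (↠-derivable)
  open CanonicalModel R Var using (sound; truth; truth⁻¹)

  to : R ⊢ A ↠ B → L R Var (A · var p) (B · var p)
  to A↠B = ↠-derivable A↠B (var p)

  from : L R Var (A · var p) (B · var p) → R ⊢ A ↠ B
  from d = truth⁻¹ B p (sound d (truth A p done))
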